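{- Call an integer pair $[n,c]$ useful if $n\ge 2$, $c$ is a prime power with $c\equiv1\pmod{2n}$, and $c+n=\binom{k}{2}$ for some integer $k\ge 2n$. If $[n,c]$ is useful then $n\notin\{6,10,15\}$. Moreover, if $n\in\{6,10,15\}$ and $[n,c]$ satisfies all the conditions of a useful pair except that $k<2n$, then, with $d=1+(c-1)/n$, the quadruple $[n,c,k,d]$ is one of $[6,49,11,9]$, $[10,81,14,9]$, $[15,121,17,9]$. -}

module Defs where

open import Data.Nat using (ℕ; _+_; _*_; _∸_; _^_; _≤_; _<_; NonZero)
open import Data.Nat.DivMod using (_/_)
open import Data.Nat.Divisibility using (_∣_)
open import Data.Nat.Primality using (Prime)
open import Data.Nat.Combinatorics using (_C_)
open import Data.Product using (Σ; ∃; _×_)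
open import Data.Sum using (_⊎_)
open import Relation.Binary.PropositionalEquality using (_≡_)

IsPrimePower : ℕ → Set
IsPrimePower c = Σ ℕ λ p → Σ ℕ λ e → Prime p × 1 ≤ e × c ≡ p ^ e

-- all conditions of a useful pair except the bound on k, with k given explicitly:
-- n ≥ 2, c a prime power, c ≡ 1 (mod 2n), c + n = binom(k,2), k ≥ 2
-- (c ≥ 1 follows from c being a prime power, so 2n ∣ c - 1 is c ≡ 1 mod 2n)
PreUseful : ℕ → ℕ → ℕ → Set
PreUseful n c k = 2 ≤ n × IsPrimePower c × (2 * n) ∣ (c ∸ 1) × c + n ≡ k C 2 × 2 ≤ k

Useful : ℕ → ℕ → Set
Useful n c = ∃ λ k → PreUseful n c k × 2 * n ≤ k

dOf : (n c : ℕ) → .{{NonZero n}} → ℕ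
dOf n c = 1 + (c ∸ 1) / n

Special : ℕ → Set
Special n = n ≡ 6 ⊎ n ≡ 10 ⊎ n ≡ 15

module Submission where

-- Write n = C(b+1, 2), so that n = 6, 10, 15 for b = 3, 4, 5, and k = b + 1 + x.  Then
-- c + n = C(k, 2) becomes x (x + g) = 2c with g = 2b + 1.  As c = p^e, one of the two
-- factors absorbs the 2, leaving a factorisation of p^e into two powers of p; the smaller
-- divides the larger, and since the factors differ by about g this forces x ∣ 2g.  The
-- finitely many x ∣ 2g are then checked by computation: exactly one of them satisfies
-- 2n ∣ c - 1, and it gives k < 2n.

open import Data.Nat
open import Data.Nat.Properties
open import Data.Nat.Divisibility
open import Data.Nat.DivMod using (_/_; m*n/n≡m)
open import Data.Nat.Primality using (Prime; prime[2]; prime⇒nonZero; prime⇒nonTrivial; prime⇒irreducible; euclidsLemma)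
open import Data.Nat.Coprimality using (Coprime; coprime-divisor)
open import Data.Nat.Combinatorics using (_C_; nC1≡n; nCk+nC[k+1]≡[n+1]C[k+1])
open import Data.Nat.Tactic.RingSolver using (solve-∀)
open import Data.Product using (∃; _×_; _,_; proj₁)
open import Data.Sum using (_⊎_; inj₁; inj₂)
open import Relation.Nullary using (¬_; Dec; yes; no; contradiction)
open import Relation.Nullary.Decidable using (True; toWitness; from-yes; _×-dec_; _→-dec_)
open import Relation.Unary using (Decidable)
open import Relation.Binary.PropositionalEquality
open import Defs

∣p^e⇒≡p^i : ∀ {p m} → Prime p → ∀ e → m ∣ p ^ e → ∃ λ i → m ≡ p ^ i
∣p^e⇒≡p^i pp zero m∣1 = 0 , ∣1⇒≡1 m∣1
∣p^e⇒≡p^i {p} {m} pp (suc e) m∣p^[1+e] with p ∣? m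
... | yes (divides q refl) =
  let instance _ = prime⇒nonZero pp
      i , q≡p^i = ∣p^e⇒≡p^i pp e (*-cancelʳ-∣ {q} p (subst (q * p ∣_) (*-comm p (p ^ e)) m∣p^[1+e]))
  in suc i , trans (cong (_* p) q≡p^i) (*-comm (p ^ i) p)
... | no p∤m = ∣p^e⇒≡p^i pp e (coprime-divisor m⊥p m∣p^[1+e])
  where
  m⊥p : Coprime m p
  m⊥p (d∣m , d∣p) with prime⇒irreducible pp d∣p
  ... | inj₁ d≡1 = d≡1
  ... | inj₂ refl = contradiction d∣m p∤m

p^i≤p^j⇒p^i∣p^j : ∀ {p i j} → 1 < p → p ^ i ≤ p ^ j → p ^ i ∣ p ^ j
p^i≤p^j⇒p^i∣p^j {p} {i} {j} 1<p p^i≤p^j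
  with m≤n⇒∃[o]m+o≡n {i} {j} (≮⇒≥ λ j<i → <⇒≱ (^-monoʳ-< p 1<p j<i) p^i≤p^j)
... | t , refl = divides (p ^ t) (trans (^-distribˡ-+-* p i t) (*-comm (p ^ i) (p ^ t)))

m*n≡p^e∧m≤n⇒m∣n : ∀ {p m n e} → Prime p → m * n ≡ p ^ e → m ≤ n → m ∣ n
m*n≡p^e∧m≤n⇒m∣n {p} {m} {n} {e} pp mn≡p^e m≤n
  with ∣p^e⇒≡p^i pp e (divides n (trans (sym mn≡p^e) (*-comm m n)))
     | ∣p^e⇒≡p^i pp e (divides m (sym mn≡p^e))
... | i , refl | j , refl = p^i≤p^j⇒p^i∣p^j {p} {i} {j} (nonTrivial⇒n>1 p {{prime⇒nonTrivial pp}}) m≤n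

m∣n∧m<n⇒2*m≤n : ∀ {m n} → m ∣ n → m < n → 2 * m ≤ n
m∣n∧m<n⇒2*m≤n {m} {n} m∣n m<n = begin
  2 * m              ≤⟨ *-monoˡ-≤ m (quotient>1 m∣n m<n) ⟩
  quotient m∣n * m   ≡⟨ sym (m∣n⇒n≡quotient*m m∣n) ⟩
  n                  ∎
  where open ≤-Reasoning

x*y≡p^e∧x+g≡y*2⇒x∣g : ∀ {p e x y g} → Prime p → 0 < g → x * y ≡ p ^ e → x + g ≡ y * 2 → x ∣ g
x*y≡p^e∧x+g≡y*2⇒x∣g {p} {e} {x} {y} {g} pp g>0 xy≡p^e x+g≡2y with x ≤? y
... | yes x≤y =
  ∣m+n∣m⇒∣n (subst (x ∣_) (sym x+g≡2y) (∣m⇒∣m*n 2 (m*n≡p^e∧m≤n⇒m∣n {e = e} pp xy≡p^e x≤y))) ∣-refl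
... | no x≰y = contradiction (begin-strict
    x       <⟨ m<m+n x g>0 ⟩
    x + g   ≡⟨ trans x+g≡2y (*-comm y 2) ⟩
    2 * y   ≤⟨ m∣n∧m<n⇒2*m≤n (m*n≡p^e∧m≤n⇒m∣n {e = e} pp (trans (*-comm y x) xy≡p^e) (<⇒≤ y<x)) y<x ⟩
    x       ∎) (<-irrefl refl)
  where
  open ≤-Reasoning
  y<x : y < x
  y<x = ≰⇒> x≰y

x*[x+g]≡2*p^e⇒x∣2*g : ∀ {p e x g} → Prime p → 0 < g → x * (x + g) ≡ 2 * p ^ e → x ∣ 2 * g
x*[x+g]≡2*p^e⇒x∣2*g {p} {e} {x} {g} pp g>0 x[x+g]≡2p^e
  with euclidsLemma x (x + g) prime[2] (divides (p ^ e) (trans x[x+g]≡2p^e (*-comm 2 (p ^ e))))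
... | inj₁ (divides y refl) = subst (y * 2 ∣_) (*-comm g 2) (*-monoˡ-∣ 2 y∣g)
  where
  y[2y+g]≡p^e : y * (y * 2 + g) ≡ p ^ e
  y[2y+g]≡p^e = *-cancelˡ-≡ _ _ 2 (trans (sym (*-assoc 2 y _))
    (trans (cong (_* (y * 2 + g)) (*-comm 2 y)) x[x+g]≡2p^e))
  y∣g : y ∣ g
  y∣g = ∣m+n∣m⇒∣n (m*n≡p^e∧m≤n⇒m∣n {e = e} pp y[2y+g]≡p^e (≤-trans (m≤m*n y 2) (m≤m+n (y * 2) g)))
                   (m∣m*n 2)
... | inj₂ (divides y x+g≡2y) = ∣n⇒∣m*n 2 (x*y≡p^e∧x+g≡y*2⇒x∣g {e = e} pp g>0 xy≡p^e x+g≡2y)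
  where
  xy≡p^e : x * y ≡ p ^ e
  xy≡p^e = *-cancelˡ-≡ _ _ 2 (begin
    2 * (x * y)   ≡⟨ *-comm 2 (x * y) ⟩
    x * y * 2     ≡⟨ *-assoc x y 2 ⟩
    x * (y * 2)   ≡⟨ cong (x *_) x+g≡2y ⟨
    x * (x + g)   ≡⟨ x[x+g]≡2p^e ⟩
    2 * p ^ e     ∎)
    where open ≡-Reasoning

2*[nC2]≡n*[n∸1] : ∀ n → 2 * (n C 2) ≡ n * (n ∸ 1)
2*[nC2]≡n*[n∸1] zero = refl
2*[nC2]≡n*[n∸1] (suc zero) = refl
2*[nC2]≡n*[n∸1] (suc (suc n)) = begin
  2 * (suc (suc n) C 2)            ≡⟨ cong (2 *_) (nCk+nC[k+1]≡[n+1]C[k+1] (suc n) 1) ⟨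
  2 * (suc n C 1 + suc n C 2)      ≡⟨ cong (λ m → 2 * (m + suc n C 2)) (nC1≡n (suc n)) ⟩
  2 * (suc n + suc n C 2)          ≡⟨ *-distribˡ-+ 2 (suc n) (suc n C 2) ⟩
  2 * suc n + 2 * (suc n C 2)      ≡⟨ cong (2 * suc n +_) (2*[nC2]≡n*[n∸1] (suc n)) ⟩
  2 * suc n + suc n * n            ≡⟨ cong (2 * suc n +_) (*-comm (suc n) n) ⟩
  2 * suc n + n * suc n            ≡⟨ *-distribʳ-+ (suc n) 2 n ⟨
  suc (suc n) * suc n              ∎
  where open ≡-Reasoning

nC2-mono-≤ : ∀ {m n} → m ≤ n → m C 2 ≤ n C 2
nC2-mono-≤ {m} {n} m≤n = *-cancelˡ-≤ 2 (begin
  2 * (m C 2)    ≡⟨ 2*[nC2]≡n*[n∸1] m ⟩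
  m * (m ∸ 1)    ≤⟨ *-mono-≤ m≤n (∸-monoˡ-≤ 1 m≤n) ⟩
  n * (n ∸ 1)    ≡⟨ 2*[nC2]≡n*[n∸1] n ⟨
  2 * (n C 2)    ∎)
  where open ≤-Reasoning

2*[[1+b+x]C2] : ∀ b x → 2 * ((suc b + x) C 2) ≡ 2 * (suc b C 2) + x * (x + suc (2 * b))
2*[[1+b+x]C2] b x = begin
  2 * ((suc b + x) C 2)               ≡⟨ 2*[nC2]≡n*[n∸1] (suc b + x) ⟩
  (suc b + x) * (b + x)               ≡⟨ expand b x ⟩
  suc b * b + x * (x + suc (2 * b))   ≡⟨ cong (_+ x * (x + suc (2 * b))) (2*[nC2]≡n*[n∸1] (suc b)) ⟨
  2 * (suc b C 2) + x * (x + suc (2 * b)) ∎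
  where
  open ≡-Reasoning
  expand : ∀ b x → (suc b + x) * (b + x) ≡ suc b * b + x * (x + suc (2 * b))
  expand = solve-∀

nC2<mC2⇒n<m : ∀ {m n} → n C 2 < m C 2 → n < m
nC2<mC2⇒n<m nC2<mC2 = ≰⇒> λ m≤n → <⇒≱ nC2<mC2 (nC2-mono-≤ m≤n)

module Triangular (b : ℕ) where

  g : ℕ
  g = suc (2 * b)

  c[_] : ℕ → ℕ
  c[ x ] = x * (x + g) / 2

  Candidate : ℕ → Set
  Candidate x = x ∣ 2 * g × 2 * (suc b C 2) ∣ c[ x ] ∸ 1

  candidate? : Decidable Candidate
  candidate? x = x ∣? 2 * g ×-dec 2 * (suc b C 2) ∣? c[ x ] ∸ 1

  preUseful⇒candidate : ∀ {c k} → PreUseful (suc b C 2) c k →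
                        ∃ λ x → k ≡ suc b + x × c ≡ c[ x ] × Candidate x
  preUseful⇒candidate {k = k} (_ , (p , e , pp , _ , refl) , 2n∣c-1 , c+n≡kC2 , _)
    with m≤n⇒∃[o]m+o≡n {suc b} {k} (<⇒≤ 1+b<k)
    where
    1+b<k : suc b < k
    1+b<k = nC2<mC2⇒n<m (subst (suc b C 2 <_) c+n≡kC2 (m<n+m (suc b C 2) (m^n>0 p {{prime⇒nonZero pp}} e)))
  ... | x , refl = x , refl , c≡c[x] , x*[x+g]≡2*p^e⇒x∣2*g {e = e} pp (s≤s z≤n) x[x+g]≡2p^e
                 , subst (λ c → 2 * (suc b C 2) ∣ c ∸ 1) c≡c[x] 2n∣c-1
    where
    x[x+g]≡2p^e : x * (x + g) ≡ 2 * p ^ e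
    x[x+g]≡2p^e = sym (+-cancelˡ-≡ (2 * (suc b C 2)) _ _ (begin
      2 * (suc b C 2) + 2 * p ^ e    ≡⟨ *-distribˡ-+ 2 (suc b C 2) (p ^ e) ⟨
      2 * (suc b C 2 + p ^ e)        ≡⟨ cong (2 *_) (trans (+-comm (suc b C 2) (p ^ e)) c+n≡kC2) ⟩
      2 * ((suc b + x) C 2)          ≡⟨ 2*[[1+b+x]C2] b x ⟩
      2 * (suc b C 2) + x * (x + g)  ∎))
      where open ≡-Reasoning
    c≡c[x] : p ^ e ≡ c[ x ]
    c≡c[x] = sym (trans (cong (_/ 2) (trans x[x+g]≡2p^e (*-comm 2 (p ^ e)))) (m*n/n≡m (p ^ e) 2))

  OnlyCandidate : ℕ → Set
  OnlyCandidate x₀ = ∀ {x} → x < suc (2 * g) → Candidate x → x ≡ x₀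

  onlyCandidate? : ∀ x₀ → Dec (OnlyCandidate x₀)
  onlyCandidate? x₀ = allUpTo? (λ x → candidate? x →-dec x ≟ x₀) (suc (2 * g))

  unique-candidate : ∀ {x₀ c k} → OnlyCandidate x₀ →
                     PreUseful (suc b C 2) c k → k ≡ suc b + x₀ × c ≡ c[ x₀ ]
  unique-candidate only-x₀ pre with preUseful⇒candidate pre
  ... | x , refl , refl , cand@(x∣2g , _) with only-x₀ (s≤s (∣⇒≤ x∣2g)) cand
  ... | refl = refl , refl

preUseful[6] : ∀ {c k} → PreUseful 6 c k → k ≡ 11 × c ≡ 49
preUseful[6] = Triangular.unique-candidate 3 (from-yes (Triangular.onlyCandidate? 3 7))

preUseful[10] : ∀ {c k} → PreUseful 10 c k → k ≡ 14 × c ≡ 81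
preUseful[10] = Triangular.unique-candidate 4 (from-yes (Triangular.onlyCandidate? 4 9))

preUseful[15] : ∀ {c k} → PreUseful 15 c k → k ≡ 17 × c ≡ 121
preUseful[15] = Triangular.unique-candidate 5 (from-yes (Triangular.onlyCandidate? 5 11))

lemma5p7 : ((n c : ℕ) → Useful n c → ¬ Special n)
    × ((n c k : ℕ) → .{{_ : NonZero n}} → Special n → PreUseful n c k → k < 2 * n →
        (n ≡ 6 × c ≡ 49 × k ≡ 11 × dOf n c ≡ 9)
        ⊎ (n ≡ 10 × c ≡ 81 × k ≡ 14 × dOf n c ≡ 9)
        ⊎ (n ≡ 15 × c ≡ 121 × k ≡ 17 × dOf n c ≡ 9))
lemma5p7 = notUseful , exceptional
  where
  tooSmall : ∀ {m k k₀} {k₀<m : True (k₀ <? m)} → k ≡ k₀ → ¬ (m ≤ k)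
  tooSmall {k₀<m = k₀<m} refl = <⇒≱ (toWitness k₀<m)

  notUseful : (n c : ℕ) → Useful n c → ¬ Special n
  notUseful _ _ (_ , pre , 2n≤k) (inj₁ refl)         = tooSmall (proj₁ (preUseful[6] pre)) 2n≤k
  notUseful _ _ (_ , pre , 2n≤k) (inj₂ (inj₁ refl))  = tooSmall (proj₁ (preUseful[10] pre)) 2n≤k
  notUseful _ _ (_ , pre , 2n≤k) (inj₂ (inj₂ refl))  = tooSmall (proj₁ (preUseful[15] pre)) 2n≤k

  exceptional : (n c k : ℕ) → .{{_ : NonZero n}} → Special n → PreUseful n c k → k < 2 * n →
        (n ≡ 6 × c ≡ 49 × k ≡ 11 × dOf n c ≡ 9)
        ⊎ (n ≡ 10 × c ≡ 81 × k ≡ 14 × dOf n c ≡ 9)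
        ⊎ (n ≡ 15 × c ≡ 121 × k ≡ 17 × dOf n c ≡ 9)
  exceptional _ _ _ (inj₁ refl) pre _ with preUseful[6] pre
  ... | refl , refl = inj₁ (refl , refl , refl , refl)
  exceptional _ _ _ (inj₂ (inj₁ refl)) pre _ with preUseful[10] pre
  ... | refl , refl = inj₂ (inj₁ (refl , refl , refl , refl))
  exceptional _ _ _ (inj₂ (inj₂ refl)) pre _ with preUseful[15] pre
  ... | refl , refl = inj₂ (inj₂ (refl , refl , refl , refl))
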